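{- Let $n\ge1$ and let $W\in\mathcal{D}_n$ be any Dyck path. Then for every $k\ge 0$, $$\sum_{w\in\mathcal{D}_n,\ \mathrm{des}_W(w)=k} q^{\mathrm{MAJ}_W(w)} = N_q(n,k),$$ i.e. the bi-statistic $(\mathrm{des}_W,\mathrm{MAJ}_W)$ has the $q$-Narayana distribution.
   Context: A Dyck path of length $2n$ is a lattice path from $(0,0)$ to $(n,n)$ with steps $v=(0,1)$, $h=(1,0)$ never going below $x=y$; $\mathcal{D}_n$ is the set of these. Code a Dyck path in letters $v_1,v_2,\dots,h_1,h_2,\dots$, where $v_i$ (resp. $h_i$) is the $i$-th vertical (resp. horizontal) step. For Dyck paths $W$ and $w=w_1\cdots w_{2n}$, $D_W(w)=\{i\in[2n-1]: w_{i+1}\text{ occurs before } w_i \text{ in } W\}$, $\mathrm{des}_W(w)=|D_W(w)|$ and $\mathrm{MAJ}_W(w)=\sum_{i\in D_W(w)} i$. Let $\mathrm{des}=\mathrm{des}_{W_0}$ and $\mathrm{MAJ}=\mathrm{MAJ}_{W_0}$ where $W_0=v_1v_2\cdots v_nh_1h_2\cdots h_n$ (so $\mathrm{des}(w)$ is the number of valleys $hv$ of $w$). The $q$-Narayana numbers are $N_q(n,k)=\sum_{w\in\mathcal{D}_n,\ \mathrm{des}(w)=k} q^{\mathrm{MAJ}(w)}$. -}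

module Defs where

open import Data.Bool using (Bool; true; false; _∧_; if_then_else_)
open import Data.Nat using (ℕ; zero; suc; _+_; _*_; _<ᵇ_; _≡ᵇ_)
open import Data.Product using (_×_; _,_)
open import Data.List using (List; []; _∷_; length; filterᵇ; map; _++_)

-- Words in the alphabet {v,h}: true = v = (0,1), false = h = (1,0).
Word : Set
Word = List Bool

allWords : ℕ → List Word
allWords zero    = [] ∷ []
allWords (suc m) = map (true ∷_) (allWords m) ++ map (false ∷_) (allWords m)

-- Dyck check with current height (#v - #h so far): never below the
-- diagonal and ending on it.
dyckFrom : ℕ → Word → Bool
dyckFrom zero    []          = true
dyckFrom (suc _) []          = false
dyckFrom h       (true ∷ w)  = dyckFrom (suc h) w
dyckFrom zero    (false ∷ w) = false
dyckFrom (suc h) (false ∷ w) = dyckFrom h w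

isDyck : Word → Bool
isDyck = dyckFrom zero

𝒟 : ℕ → List Word
𝒟 n = filterᵇ isDyck (allWords (n + n))

-- A letter: v_j is (true , j), h_j is (false , j), j ≥ 1.
Letter : Set
Letter = Bool × ℕ

codeFrom : ℕ → ℕ → Word → List Letter
codeFrom a b []          = []
codeFrom a b (true ∷ w)  = (true , suc a) ∷ codeFrom (suc a) b w
codeFrom a b (false ∷ w) = (false , suc b) ∷ codeFrom a (suc b) w

code : Word → List Letter
code = codeFrom zero zero

eqBool : Bool → Bool → Bool
eqBool true  true  = true
eqBool false false = true
eqBool _     _     = false

eqLetter : Letter → Letter → Bool
eqLetter (x , i) (y , j) = eqBool x y ∧ (i ≡ᵇ j)

-- 0-based position of a letter in a coded word (length if absent).
pos : Letter → List Letter → ℕ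
pos x []       = zero
pos x (y ∷ ys) = if eqLetter x y then zero else suc (pos x ys)

-- Is i (1-based index of the first letter of the pair) a W-descent:
-- w_{i+1} occurs before w_i in W.
isDescW : List Letter → Letter → Letter → Bool
isDescW cW x y = pos y cW <ᵇ pos x cW

-- des_W and MAJ_W of a coded word, scanning pairs (w_i , w_{i+1}),
-- i the 1-based index of the current letter.
desFrom : List Letter → List Letter → ℕ
desFrom cW []           = zero
desFrom cW (x ∷ [])     = zero
desFrom cW (x ∷ y ∷ ys) =
  (if isDescW cW x y then 1 else 0) + desFrom cW (y ∷ ys)

majFrom : List Letter → ℕ → List Letter → ℕ
majFrom cW i []           = zero
majFrom cW i (x ∷ [])     = zero
majFrom cW i (x ∷ y ∷ ys) =
  (if isDescW cW x y then i else 0) + majFrom cW (suc i) (y ∷ ys)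

desW : Word → Word → ℕ
desW W w = desFrom (code W) (code w)

MAJW : Word → Word → ℕ
MAJW W w = majFrom (code W) 1 (code w)

replicateB : ℕ → Bool → Word
replicateB zero    b = []
replicateB (suc n) b = b ∷ replicateB n b

W₀ : ℕ → Word
W₀ n = replicateB n true ++ replicateB n false

des : ℕ → Word → ℕ
des n = desW (W₀ n)

MAJ : ℕ → Word → ℕ
MAJ n = MAJW (W₀ n)

-- Coefficient of q^m in Σ_{w ∈ 𝒟 n, des_W w = k} q^{MAJ_W w}:
-- the polynomial is represented by its coefficient function ℕ → ℕ.
distW : Word → ℕ → ℕ → ℕ → ℕ
distW W n k m =
  length (filterᵇ (λ w → (desW W w ≡ᵇ k) ∧ (MAJW W w ≡ᵇ m)) (𝒟 n))

Nq : ℕ → ℕ → ℕ → ℕ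
Nq n k m =
  length (filterᵇ (λ w → (des n w ≡ᵇ k) ∧ (MAJ n w ≡ᵇ m)) (𝒟 n))

-- Let W = p hv s have a valley and let W' = p vh s. In the letter coding, W' is W
-- with the adjacent letters B = h_{β+1}, A = v_{α+1} exchanged, where α and β count
-- the v's and h's of p. Exchanging the (α+1)-th v and the (β+1)-th h of a Dyck path
-- w whenever they are adjacent is a bijection of Dyck paths (the height condition
-- comes from W being Dyck), and it carries the W-descents of w to the W'-descents of
-- its image at the same positions: transposing two letters of consecutive ranks in
-- the reference word changes only their mutual comparison, which matters only where
-- the two letters are adjacent in w, and that is exactly where the bijection swaps them.
-- Hence (des_W, MAJ_W) and (des_W', MAJ_W') are equidistributed. Turning a valley
-- into a peak lowers the number of inversions, and the only Dyck path without a
-- valley hv is W₀ = vⁿhⁿ.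

module Submission where

open import Defs
open import Data.Bool using (Bool; true; false; T; _∧_; if_then_else_)
open import Data.Bool.Properties using () renaming (_≟_ to _≟ᵇ_)
open import Data.List using (List; []; _∷_; _++_; map; length; filterᵇ)
open import Data.List.Membership.Propositional using (_∈_; _∉_)
open import Data.List.Membership.Propositional.Properties using (∈-++⁺ʳ)
open import Data.List.Properties using (filter-++; length-++)
open import Data.List.Relation.Unary.Any using (here; there)
open import Data.List.Relation.Unary.Linked as Linked using (Linked; []; [-]; _∷_)
open import Data.Nat using (ℕ; zero; suc; _+_; _≤_; _<_; _<ᵇ_; _≡ᵇ_; z≤n; s≤s)
open import Data.Nat.Properties
  using ( +-suc; +-identityʳ; m+1+n≢m; m≤m+n; n<1+n; <-irrefl; <-trans; ≤-trans; ≤-reflexive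
        ; suc-injective; +-commutativeSemigroup)
  renaming (_≟_ to _≟ⁿ_)
open import Algebra.Properties.CommutativeSemigroup +-commutativeSemigroup using (interchange)
open import Data.Product using (_×_; _,_; proj₁; proj₂; ∃-syntax)
open import Data.Product.Properties using (≡-dec)
open import Data.Sum using (_⊎_; inj₁; inj₂)
open import Function using (_∘_; flip)
open import Relation.Binary.Definitions using (DecidableEquality)
open import Relation.Binary.PropositionalEquality
open import Relation.Nullary using (¬_; yes; no; does)
open import Relation.Nullary.Decidable using (T?)
open import Relation.Nullary.Negation using (contradiction)

countWords : ℕ → (Word → Bool) → ℕ
countWords zero    F = if F [] then 1 else 0
countWords (suc m) F = countWords m (F ∘ (true ∷_)) + countWords m (F ∘ (false ∷_))

filterᵇ-filterᵇ : ∀ {A : Set} (P Q : A → Bool) xs →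
  filterᵇ P (filterᵇ Q xs) ≡ filterᵇ (λ x → Q x ∧ P x) xs
filterᵇ-filterᵇ P Q [] = refl
filterᵇ-filterᵇ P Q (x ∷ xs) with Q x
... | false = filterᵇ-filterᵇ P Q xs
... | true with P x
...   | true  = cong (x ∷_) (filterᵇ-filterᵇ P Q xs)
...   | false = filterᵇ-filterᵇ P Q xs

length-filterᵇ-map : ∀ {A B : Set} (F : B → Bool) (f : A → B) xs →
  length (filterᵇ F (map f xs)) ≡ length (filterᵇ (F ∘ f) xs)
length-filterᵇ-map F f [] = refl
length-filterᵇ-map F f (x ∷ xs) with F (f x)
... | true  = cong suc (length-filterᵇ-map F f xs)
... | false = length-filterᵇ-map F f xs

length-filterᵇ-allWords : ∀ m F → length (filterᵇ F (allWords m)) ≡ countWords m F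
length-filterᵇ-allWords zero F with F []
... | true  = refl
... | false = refl
length-filterᵇ-allWords (suc m) F = begin
  length (filterᵇ F (map (true ∷_) ws ++ map (false ∷_) ws))
    ≡⟨ cong length (filter-++ (T? ∘ F) (map (true ∷_) ws) _) ⟩
  length (filterᵇ F (map (true ∷_) ws) ++ filterᵇ F (map (false ∷_) ws))
    ≡⟨ length-++ (filterᵇ F (map (true ∷_) ws)) ⟩
  length (filterᵇ F (map (true ∷_) ws)) + length (filterᵇ F (map (false ∷_) ws))
    ≡⟨ cong₂ _+_ (length-filterᵇ-map F (true ∷_) ws) (length-filterᵇ-map F (false ∷_) ws) ⟩
  length (filterᵇ (F ∘ (true ∷_)) ws) + length (filterᵇ (F ∘ (false ∷_)) ws)
    ≡⟨ cong₂ _+_ (length-filterᵇ-allWords m _) (length-filterᵇ-allWords m _) ⟩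
  countWords (suc m) F ∎
  where
  open ≡-Reasoning
  ws = allWords m

countWords-cong : ∀ m {F G : Word → Bool} → (∀ w → F w ≡ G w) → countWords m F ≡ countWords m G
countWords-cong zero    F≗G = cong (λ b → if b then 1 else 0) (F≗G [])
countWords-cong (suc m) F≗G =
  cong₂ _+_ (countWords-cong m (F≗G ∘ (true ∷_))) (countWords-cong m (F≗G ∘ (false ∷_)))

-- Exchanging an adjacent pair of steps

-- swapAdjacent i j w exchanges the (i+1)-th v and the (j+1)-th h of w
-- when they are adjacent, and leaves w unchanged otherwise.
swapAdjacent : ℕ → ℕ → Word → Word
swapAdjacent zero    zero    (true ∷ false ∷ w) = false ∷ true ∷ w
swapAdjacent zero    zero    (false ∷ true ∷ w) = true ∷ false ∷ w
swapAdjacent (suc i) j       (true ∷ w)         = true ∷ swapAdjacent i j w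
swapAdjacent i       (suc j) (false ∷ w)        = false ∷ swapAdjacent i j w
swapAdjacent _       _       w                  = w

swapAdjacent-false : ∀ i j w → swapAdjacent i (suc j) (false ∷ w) ≡ false ∷ swapAdjacent i j w
swapAdjacent-false zero    j w = refl
swapAdjacent-false (suc i) j w = refl

countWords-swapAdjacent : ∀ m i j F → countWords m (F ∘ swapAdjacent i j) ≡ countWords m F
countWords-swapAdjacent zero          zero    zero    F = refl
countWords-swapAdjacent zero          zero    (suc j) F = refl
countWords-swapAdjacent zero          (suc i) zero    F = refl
countWords-swapAdjacent zero          (suc i) (suc j) F = refl
countWords-swapAdjacent (suc zero)    zero    zero    F = refl
countWords-swapAdjacent (suc (suc m)) zero    zero    F =
  interchange (c (λ w → F (true ∷ true ∷ w))) (c (λ w → F (false ∷ true ∷ w)))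
              (c (λ w → F (true ∷ false ∷ w))) (c (λ w → F (false ∷ false ∷ w)))
  where c = countWords m
countWords-swapAdjacent (suc m) zero (suc j) F =
  cong (countWords m (F ∘ (true ∷_)) +_) (countWords-swapAdjacent m zero j (F ∘ (false ∷_)))
countWords-swapAdjacent (suc m) (suc i) zero F =
  cong (_+ countWords m (F ∘ (false ∷_))) (countWords-swapAdjacent m i zero (F ∘ (true ∷_)))
countWords-swapAdjacent (suc m) (suc i) (suc j) F =
  cong₂ _+_ (countWords-swapAdjacent m i (suc j) (F ∘ (true ∷_)))
            (countWords-swapAdjacent m (suc i) j (F ∘ (false ∷_)))

descentSum : {X : Set} → (X → ℕ) → (ℕ → ℕ) → ℕ → List X → ℕ
descentSum rank f i []           = 0
descentSum rank f i (x ∷ [])     = 0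
descentSum rank f i (x ∷ y ∷ ys) =
  (if rank y <ᵇ rank x then f i else 0) + descentSum rank f (suc i) (y ∷ ys)

module _ {X : Set} where

  descentSum-cong : ∀ {rank rank' : X → ℕ} → (∀ x → rank x ≡ rank' x) →
    ∀ f i xs → descentSum rank f i xs ≡ descentSum rank' f i xs
  descentSum-cong r≗r' f i []           = refl
  descentSum-cong r≗r' f i (x ∷ [])     = refl
  descentSum-cong r≗r' f i (x ∷ y ∷ ys) =
    cong₂ _+_ (cong₂ (λ a b → if a <ᵇ b then f i else 0) (r≗r' y) (r≗r' x))
              (descentSum-cong r≗r' f (suc i) (y ∷ ys))

  descentSum-map : ∀ {Y : Set} (rank : X → ℕ) (g : Y → X) f i ys →
    descentSum rank f i (map g ys) ≡ descentSum (rank ∘ g) f i ys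
  descentSum-map rank g f i []           = refl
  descentSum-map rank g f i (x ∷ [])     = refl
  descentSum-map rank g f i (x ∷ y ∷ ys) = cong (_ +_) (descentSum-map rank g f (suc i) (y ∷ ys))

  descentSum-congLinked : ∀ {rank rank' : X → ℕ} {f i xs} →
    Linked (λ x y → (rank y <ᵇ rank x) ≡ (rank' y <ᵇ rank' x)) xs →
    descentSum rank f i xs ≡ descentSum rank' f i xs
  descentSum-congLinked []              = refl
  descentSum-congLinked [-]             = refl
  descentSum-congLinked {f = f} {i} (same ∷ rest) =
    cong₂ _+_ (cong (λ b → if b then f i else 0) same) (descentSum-congLinked rest)

desFrom-descentSum : ∀ cW i L → desFrom cW L ≡ descentSum (flip pos cW) (λ _ → 1) i L
desFrom-descentSum cW i []           = refl
desFrom-descentSum cW i (x ∷ [])     = refl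
desFrom-descentSum cW i (x ∷ y ∷ ys) = cong (_ +_) (desFrom-descentSum cW (suc i) (y ∷ ys))

majFrom-descentSum : ∀ cW i L → majFrom cW i L ≡ descentSum (flip pos cW) (λ j → j) i L
majFrom-descentSum cW i []           = refl
majFrom-descentSum cW i (x ∷ [])     = refl
majFrom-descentSum cW i (x ∷ y ∷ ys) = cong (_ +_) (majFrom-descentSum cW (suc i) (y ∷ ys))

<ᵇ-irrefl : ∀ n → (n <ᵇ n) ≡ false
<ᵇ-irrefl zero    = refl
<ᵇ-irrefl (suc n) = <ᵇ-irrefl n

<ᵇ-sucʳ : ∀ m n → m ≢ n → (m <ᵇ suc n) ≡ (m <ᵇ n)
<ᵇ-sucʳ zero    zero    m≢n = contradiction refl m≢n
<ᵇ-sucʳ zero    (suc n) _   = refl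
<ᵇ-sucʳ (suc m) zero    _   = refl
<ᵇ-sucʳ (suc m) (suc n) m≢n = <ᵇ-sucʳ m n (m≢n ∘ cong suc)

<ᵇ-sucˡ : ∀ m n → n ≢ suc m → (suc m <ᵇ n) ≡ (m <ᵇ n)
<ᵇ-sucˡ m       zero          _   = refl
<ᵇ-sucˡ zero    (suc zero)    n≢1 = contradiction refl n≢1
<ᵇ-sucˡ zero    (suc (suc n)) _   = refl
<ᵇ-sucˡ (suc m) (suc n)       n≢m = <ᵇ-sucˡ m n (n≢m ∘ cong suc)

module Transposition {X : Set} (_≟_ : DecidableEquality X) (A B : X) (A≢B : A ≢ B) where

  data Role (x : X) : Set where
    isA   : x ≡ A → Role x
    isB   : x ≡ B → Role x
    other : x ≢ A → x ≢ B → Role x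

  role : ∀ x → Role x
  role x with x ≟ A | x ≟ B
  ... | yes x≡A | _       = isA x≡A
  ... | no _    | yes x≡B = isB x≡B
  ... | no x≢A  | no x≢B  = other x≢A x≢B

  transpose : X → X
  transpose x with role x
  ... | isA _     = B
  ... | isB _     = A
  ... | other _ _ = x

  transpose-A : transpose A ≡ B
  transpose-A with role A
  ... | isA _       = refl
  ... | isB A≡B     = contradiction A≡B A≢B
  ... | other A≢A _ = contradiction refl A≢A

  transpose-B : transpose B ≡ A
  transpose-B with role B
  ... | isA B≡A     = contradiction (sym B≡A) A≢B
  ... | isB _       = refl
  ... | other _ B≢B = contradiction refl B≢B

  transpose-fixes : ∀ {x} → x ≢ A → x ≢ B → transpose x ≡ x
  transpose-fixes {x} x≢A x≢B with role x
  ... | isA x≡A   = contradiction x≡A x≢A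
  ... | isB x≡B   = contradiction x≡B x≢B
  ... | other _ _ = refl

  transpose-involutive : ∀ x → transpose (transpose x) ≡ x
  transpose-involutive x with role x
  ... | isA x≡A         = trans transpose-B (sym x≡A)
  ... | isB x≡B         = trans transpose-A (sym x≡B)
  ... | other x≢A x≢B   = transpose-fixes x≢A x≢B

  map-transpose-fixes : ∀ {xs} → A ∉ xs → B ∉ xs → map transpose xs ≡ xs
  map-transpose-fixes {[]}     A∉ B∉ = refl
  map-transpose-fixes {x ∷ xs} A∉ B∉ =
    cong₂ _∷_ (transpose-fixes (A∉ ∘ here ∘ sym) (B∉ ∘ here ∘ sym))
              (map-transpose-fixes (A∉ ∘ there) (B∉ ∘ there))

  Apart : X → X → Set
  Apart x y = ¬ (x ≡ A × y ≡ B) × ¬ (x ≡ B × y ≡ A)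

  apart-A : ∀ {y} → y ≢ B → Apart A y
  apart-A y≢B = (y≢B ∘ proj₂) , (A≢B ∘ proj₁)

  apart-B : ∀ {y} → y ≢ A → Apart B y
  apart-B y≢A = (A≢B ∘ sym ∘ proj₁) , (y≢A ∘ proj₂)

  apart-other : ∀ {x y} → x ≢ A → x ≢ B → Apart x y
  apart-other x≢A x≢B = (x≢A ∘ proj₁) , (x≢B ∘ proj₁)

  linked-∉A : ∀ {xs} → A ∉ xs → Linked Apart xs
  linked-∉A {[]}         _  = []
  linked-∉A {x ∷ []}     _  = [-]
  linked-∉A {x ∷ y ∷ xs} A∉ =
    ((A∉ ∘ here ∘ sym ∘ proj₁) , (A∉ ∘ there ∘ here ∘ sym ∘ proj₂)) ∷ linked-∉A (A∉ ∘ there)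

  linked-∉B : ∀ {xs} → B ∉ xs → Linked Apart xs
  linked-∉B {[]}         _  = []
  linked-∉B {x ∷ []}     _  = [-]
  linked-∉B {x ∷ y ∷ xs} B∉ =
    ((B∉ ∘ there ∘ here ∘ sym ∘ proj₂) , (B∉ ∘ here ∘ sym ∘ proj₁)) ∷ linked-∉B (B∉ ∘ there)

  data Exchanged : List X → List X → Set where
    swapped : ∀ {xs ys} → map transpose xs ≡ ys → Exchanged xs ys
    apart   : ∀ {xs} → Linked Apart xs → Exchanged xs xs

  Exchanged-∷ : ∀ {x xs ys} → x ≢ A → x ≢ B → Exchanged xs ys → Exchanged (x ∷ xs) (x ∷ ys)
  Exchanged-∷ x≢A x≢B (swapped eq)           = swapped (cong₂ _∷_ (transpose-fixes x≢A x≢B) eq)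
  Exchanged-∷ x≢A x≢B (apart {[]} _)         = apart [-]
  Exchanged-∷ x≢A x≢B (apart {y ∷ xs} l)     = apart (apart-other x≢A x≢B ∷ l)

  record ConsecutiveRanks (rank : X → ℕ) : Set where
    field
      rank-A : rank A ≡ suc (rank B)
      only-A : ∀ {x} → rank x ≡ rank A → x ≡ A
      only-B : ∀ {x} → rank x ≡ rank B → x ≡ B

  module _ {rank : X → ℕ} (ranks : ConsecutiveRanks rank) where
    open ConsecutiveRanks ranks

    compare-transpose : ∀ {x y} → Apart x y →
      (rank (transpose y) <ᵇ rank (transpose x)) ≡ (rank y <ᵇ rank x)
    compare-transpose {x} {y} (¬AB , ¬BA) with role x | role y
    ... | isA x≡A | isA y≡A rewrite x≡A | y≡A = trans (<ᵇ-irrefl (rank B)) (sym (<ᵇ-irrefl (rank A)))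
    ... | isB x≡B | isB y≡B rewrite x≡B | y≡B = trans (<ᵇ-irrefl (rank A)) (sym (<ᵇ-irrefl (rank B)))
    ... | isA x≡A | isB y≡B = contradiction (x≡A , y≡B) ¬AB
    ... | isB x≡B | isA y≡A = contradiction (x≡B , y≡A) ¬BA
    ... | isA x≡A | other y≢A y≢B rewrite x≡A | rank-A =
      sym (<ᵇ-sucʳ (rank y) (rank B) (y≢B ∘ only-B))
    ... | isB x≡B | other y≢A y≢B rewrite x≡B | rank-A =
      <ᵇ-sucʳ (rank y) (rank B) (y≢B ∘ only-B)
    ... | other x≢A x≢B | isA y≡A rewrite y≡A | rank-A =
      sym (<ᵇ-sucˡ (rank B) (rank x) (λ e → x≢A (only-A (trans e (sym rank-A)))))
    ... | other x≢A x≢B | isB y≡B rewrite y≡B | rank-A =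
      <ᵇ-sucˡ (rank B) (rank x) (λ e → x≢A (only-A (trans e (sym rank-A))))
    ... | other _ _ | other _ _ = refl

    descentSum-exchanged : ∀ {rank' : X → ℕ} → (∀ x → rank' x ≡ rank (transpose x)) →
      ∀ f i {xs ys} → Exchanged xs ys → descentSum rank' f i ys ≡ descentSum rank f i xs
    descentSum-exchanged {rank'} rank'≗ f i (swapped {xs} refl) = begin
      descentSum rank' f i (map transpose xs)  ≡⟨ descentSum-map rank' transpose f i xs ⟩
      descentSum (rank' ∘ transpose) f i xs    ≡⟨ descentSum-cong rank'∘transpose≗rank f i xs ⟩
      descentSum rank f i xs                   ∎
      where
      open ≡-Reasoning
      rank'∘transpose≗rank : ∀ x → rank' (transpose x) ≡ rank x
      rank'∘transpose≗rank x = trans (rank'≗ (transpose x)) (cong rank (transpose-involutive x))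
    descentSum-exchanged {rank'} rank'≗ f i (apart {xs} linked) = begin
      descentSum rank' f i xs                ≡⟨ descentSum-cong rank'≗ f i xs ⟩
      descentSum (rank ∘ transpose) f i xs   ≡⟨ descentSum-congLinked (Linked.map compare-transpose linked) ⟩
      descentSum rank f i xs                 ∎
      where open ≡-Reasoning

_≟ℓ_ : DecidableEquality Letter
_≟ℓ_ = ≡-dec _≟ᵇ_ _≟ⁿ_

eqLetter-does : ∀ x y → eqLetter x y ≡ does (x ≟ℓ y)
eqLetter-does (true  , i) (true  , j) = refl
eqLetter-does (true  , i) (false , j) = refl
eqLetter-does (false , i) (true  , j) = refl
eqLetter-does (false , i) (false , j) = refl

pos-here : ∀ {x y} ys → x ≡ y → pos x (y ∷ ys) ≡ 0
pos-here {x} ys refl rewrite eqLetter-does x x with x ≟ℓ x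
... | yes _   = refl
... | no x≢x  = contradiction refl x≢x

pos-there : ∀ {x y} ys → x ≢ y → pos x (y ∷ ys) ≡ suc (pos x ys)
pos-there {x} {y} ys x≢y rewrite eqLetter-does x y with x ≟ℓ y
... | yes x≡y = contradiction x≡y x≢y
... | no _    = refl

pos-++ : ∀ {x} xs ys → x ∉ xs → pos x (xs ++ ys) ≡ length xs + pos x ys
pos-++ []       ys x∉ = refl
pos-++ (y ∷ xs) ys x∉ = trans (pos-there (xs ++ ys) (x∉ ∘ here)) (cong suc (pos-++ xs ys (x∉ ∘ there)))

pos-++-cong : ∀ {x} xs {ys zs} → pos x ys ≡ pos x zs → pos x (xs ++ ys) ≡ pos x (xs ++ zs)
pos-++-cong     []       eq = eq
pos-++-cong {x} (y ∷ xs) eq = cong (λ n → if eqLetter x y then 0 else suc n) (pos-++-cong xs eq)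

pos-injective : ∀ {x y} ys → y ∈ ys → pos x ys ≡ pos y ys → x ≡ y
pos-injective {x} {y} (z ∷ zs) y∈ eq with x ≟ℓ z | y ≟ℓ z
... | yes x≡z | yes y≡z = trans x≡z (sym y≡z)
... | yes x≡z | no y≢z  = contradiction (trans (sym (pos-here zs x≡z)) (trans eq (pos-there zs y≢z))) λ ()
... | no x≢z  | yes y≡z = contradiction (trans (sym (pos-here zs y≡z)) (trans (sym eq) (pos-there zs x≢z))) λ ()
... | no x≢z  | no y≢z with y∈
...   | here y≡z = contradiction y≡z y≢z
...   | there y∈zs =
  pos-injective zs y∈zs (suc-injective (trans (sym (pos-there zs x≢z)) (trans eq (pos-there zs y≢z))))

module LetterTransposition (A B : Letter) (A≢B : A ≢ B) where
  open Transposition _≟ℓ_ A B A≢B public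

  module _ (P R : List Letter) (A∉P : A ∉ P) (B∉P : B ∉ P) where

    A-first : pos A (A ∷ B ∷ R) ≡ 0
    A-first = pos-here {A} {A} (B ∷ R) refl

    B-first : pos B (B ∷ A ∷ R) ≡ 0
    B-first = pos-here {B} {B} (A ∷ R) refl

    A-second : pos A (B ∷ A ∷ R) ≡ 1
    A-second = trans (pos-there {A} {B} (A ∷ R) A≢B) (cong suc (pos-here {A} {A} R refl))

    B-second : pos B (A ∷ B ∷ R) ≡ 1
    B-second = trans (pos-there {B} {A} (B ∷ R) (A≢B ∘ sym)) (cong suc (pos-here {B} {B} R refl))

    pos-transpose : ∀ x → pos x (P ++ A ∷ B ∷ R) ≡ pos (transpose x) (P ++ B ∷ A ∷ R)
    pos-transpose x with role x
    ... | isA x≡A rewrite x≡A = begin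
      pos A (P ++ A ∷ B ∷ R)       ≡⟨ pos-++ P _ A∉P ⟩
      length P + pos A (A ∷ B ∷ R) ≡⟨ cong (length P +_) (trans A-first (sym B-first)) ⟩
      length P + pos B (B ∷ A ∷ R) ≡⟨ sym (pos-++ P _ B∉P) ⟩
      pos B (P ++ B ∷ A ∷ R)       ∎
      where open ≡-Reasoning
    ... | isB x≡B rewrite x≡B = begin
      pos B (P ++ A ∷ B ∷ R)       ≡⟨ pos-++ P _ B∉P ⟩
      length P + pos B (A ∷ B ∷ R) ≡⟨ cong (length P +_) (trans B-second (sym A-second)) ⟩
      length P + pos A (B ∷ A ∷ R) ≡⟨ sym (pos-++ P _ A∉P) ⟩
      pos A (P ++ B ∷ A ∷ R)       ∎
      where open ≡-Reasoning
    ... | other x≢A x≢B = pos-++-cong P (begin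
      pos x (A ∷ B ∷ R)    ≡⟨ pos-there (B ∷ R) x≢A ⟩
      suc (pos x (B ∷ R))  ≡⟨ cong suc (trans (pos-there R x≢B) (sym (pos-there R x≢A))) ⟩
      suc (pos x (A ∷ R))  ≡⟨ sym (pos-there (A ∷ R) x≢B) ⟩
      pos x (B ∷ A ∷ R)    ∎)
      where open ≡-Reasoning

    consecutiveRanks : ConsecutiveRanks (flip pos (P ++ B ∷ A ∷ R))
    consecutiveRanks = record
      { rank-A = begin
          pos A (P ++ B ∷ A ∷ R)       ≡⟨ pos-++ P _ A∉P ⟩
          length P + pos A (B ∷ A ∷ R) ≡⟨ cong (length P +_) A-second ⟩
          length P + 1                 ≡⟨ +-suc (length P) 0 ⟩
          suc (length P + 0)           ≡⟨ cong (λ n → suc (length P + n)) (sym B-first) ⟩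
          suc (length P + pos B (B ∷ A ∷ R)) ≡⟨ cong suc (sym (pos-++ P _ B∉P)) ⟩
          suc (pos B (P ++ B ∷ A ∷ R)) ∎
      ; only-A = pos-injective (P ++ B ∷ A ∷ R) (∈-++⁺ʳ P (there (here refl)))
      ; only-B = pos-injective (P ++ B ∷ A ∷ R) (∈-++⁺ʳ P (here refl))
      }
      where open ≡-Reasoning

vCount hCount : Word → ℕ
vCount []          = 0
vCount (true ∷ w)  = suc (vCount w)
vCount (false ∷ w) = vCount w
hCount []          = 0
hCount (true ∷ w)  = hCount w
hCount (false ∷ w) = suc (hCount w)

vCount-++ : ∀ p s → vCount (p ++ s) ≡ vCount p + vCount s
vCount-++ []          s = refl
vCount-++ (true ∷ p)  s = cong suc (vCount-++ p s)
vCount-++ (false ∷ p) s = vCount-++ p s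

codeFrom-++ : ∀ a b p s →
  codeFrom a b (p ++ s) ≡ codeFrom a b p ++ codeFrom (a + vCount p) (b + hCount p) s
codeFrom-++ a b [] s rewrite +-identityʳ a | +-identityʳ b = refl
codeFrom-++ a b (true ∷ p) s rewrite codeFrom-++ (suc a) b p s | +-suc a (vCount p) = refl
codeFrom-++ a b (false ∷ p) s rewrite codeFrom-++ a (suc b) p s | +-suc b (hCount p) = refl

codeFrom-v-bounds : ∀ {a b k} w → (true , k) ∈ codeFrom a b w → a < k × k ≤ a + vCount w
codeFrom-v-bounds {a} (true ∷ w) (here refl) =
  n<1+n a , ≤-trans (s≤s (m≤m+n a (vCount w))) (≤-reflexive (sym (+-suc a (vCount w))))
codeFrom-v-bounds {a} (true ∷ w) (there k∈) with codeFrom-v-bounds w k∈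
... | a<k , k≤ = <-trans (n<1+n a) a<k , ≤-trans k≤ (≤-reflexive (sym (+-suc a (vCount w))))
codeFrom-v-bounds (false ∷ w) (here ())
codeFrom-v-bounds (false ∷ w) (there k∈) = codeFrom-v-bounds w k∈

codeFrom-h-bounds : ∀ {a b k} w → (false , k) ∈ codeFrom a b w → b < k × k ≤ b + hCount w
codeFrom-h-bounds {b = b} (false ∷ w) (here refl) =
  n<1+n b , ≤-trans (s≤s (m≤m+n b (hCount w))) (≤-reflexive (sym (+-suc b (hCount w))))
codeFrom-h-bounds {b = b} (false ∷ w) (there k∈) with codeFrom-h-bounds w k∈
... | b<k , k≤ = <-trans (n<1+n b) b<k , ≤-trans k≤ (≤-reflexive (sym (+-suc b (hCount w))))
codeFrom-h-bounds (true ∷ w) (here ())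
codeFrom-h-bounds (true ∷ w) (there k∈) = codeFrom-h-bounds w k∈

+-suc≡⇒≢ : ∀ {a i c} → a + suc i ≡ c → a ≢ c
+-suc≡⇒≢ {a} eq a≡c = m+1+n≢m a (trans eq (sym a≡c))

index≢ : ∀ {x : Bool} {m n} → m ≢ n → (x , suc m) ≢ (x , suc n)
index≢ m≢n = m≢n ∘ suc-injective ∘ cong proj₂

module AdjacentPair (α β : ℕ) where
  A B : Letter
  A = true , suc α
  B = false , suc β

  A≢B : A ≢ B
  A≢B ()

  open LetterTransposition A B A≢B public

  A∉codeFrom : ∀ b w → A ∉ codeFrom (suc α) b w
  A∉codeFrom b w A∈ = <-irrefl refl (proj₁ (codeFrom-v-bounds w A∈))

  B∉codeFrom : ∀ a w → B ∉ codeFrom a (suc β) w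
  B∉codeFrom a w B∈ = <-irrefl refl (proj₁ (codeFrom-h-bounds w B∈))

  linked-A∷codeFrom : ∀ {b} w → b ≢ β → Linked Apart (A ∷ codeFrom (suc α) b w)
  linked-A∷codeFrom []          _   = [-]
  linked-A∷codeFrom (true ∷ w)  _   = apart-A (λ ()) ∷ linked-∉A (A∉codeFrom _ (true ∷ w))
  linked-A∷codeFrom (false ∷ w) b≢β = apart-A (index≢ b≢β) ∷ linked-∉A (A∉codeFrom _ (false ∷ w))

  linked-B∷codeFrom : ∀ {a} w → a ≢ α → Linked Apart (B ∷ codeFrom a (suc β) w)
  linked-B∷codeFrom []          _   = [-]
  linked-B∷codeFrom (false ∷ w) _   = apart-B (λ ()) ∷ linked-∉B (B∉codeFrom _ (false ∷ w))
  linked-B∷codeFrom (true ∷ w)  a≢α = apart-B (index≢ a≢α) ∷ linked-∉B (B∉codeFrom _ (true ∷ w))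

  codeFrom-swapAdjacent-here : ∀ w → Exchanged (codeFrom α β w) (codeFrom α β (swapAdjacent 0 0 w))
  codeFrom-swapAdjacent-here []                  = apart []
  codeFrom-swapAdjacent-here (true ∷ [])         = apart [-]
  codeFrom-swapAdjacent-here (false ∷ [])        = apart [-]
  codeFrom-swapAdjacent-here (true ∷ true ∷ w)   =
    apart (apart-A (λ ()) ∷ linked-∉A (A∉codeFrom β (true ∷ w)))
  codeFrom-swapAdjacent-here (false ∷ false ∷ w) =
    apart (apart-B (λ ()) ∷ linked-∉B (B∉codeFrom α (false ∷ w)))
  codeFrom-swapAdjacent-here (true ∷ false ∷ w)  =
    swapped (cong₂ _∷_ transpose-A (cong₂ _∷_ transpose-B
      (map-transpose-fixes (A∉codeFrom (suc β) w) (B∉codeFrom (suc α) w))))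
  codeFrom-swapAdjacent-here (false ∷ true ∷ w)  =
    swapped (cong₂ _∷_ transpose-B (cong₂ _∷_ transpose-A
      (map-transpose-fixes (A∉codeFrom (suc β) w) (B∉codeFrom (suc α) w))))

  codeFrom-swapAdjacent : ∀ {a b} i j w → a + i ≡ α → b + j ≡ β →
    Exchanged (codeFrom a b w) (codeFrom a b (swapAdjacent i j w))
  codeFrom-swapAdjacent {a} {b} zero zero w a≡α b≡β
    with refl ← trans (sym (+-identityʳ a)) a≡α | refl ← trans (sym (+-identityʳ b)) b≡β =
    codeFrom-swapAdjacent-here w
  codeFrom-swapAdjacent zero (suc j) [] _ _ = apart []
  codeFrom-swapAdjacent {a} zero (suc j) (true ∷ w) a≡α b≡β
    with refl ← trans (sym (+-identityʳ a)) a≡α =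
    apart (linked-A∷codeFrom w (+-suc≡⇒≢ b≡β))
  codeFrom-swapAdjacent {b = b} zero (suc j) (false ∷ w) a≡α b≡β =
    Exchanged-∷ (λ ()) (index≢ (+-suc≡⇒≢ b≡β))
      (codeFrom-swapAdjacent zero j w a≡α (trans (sym (+-suc b j)) b≡β))
  codeFrom-swapAdjacent (suc i) zero    [] _ _ = apart []
  codeFrom-swapAdjacent (suc i) (suc j) [] _ _ = apart []
  codeFrom-swapAdjacent {a} (suc i) j (true ∷ w) a≡α b≡β =
    Exchanged-∷ (index≢ (+-suc≡⇒≢ a≡α)) (λ ())
      (codeFrom-swapAdjacent i j w (trans (sym (+-suc a i)) a≡α) b≡β)
  codeFrom-swapAdjacent {b = b} (suc i) zero (false ∷ w) a≡α b≡β
    with refl ← trans (sym (+-identityʳ b)) b≡β =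
    apart (linked-B∷codeFrom w (+-suc≡⇒≢ a≡α))
  codeFrom-swapAdjacent {b = b} (suc i) (suc j) (false ∷ w) a≡α b≡β =
    Exchanged-∷ (λ ()) (index≢ (+-suc≡⇒≢ b≡β))
      (codeFrom-swapAdjacent (suc i) j w a≡α (trans (sym (+-suc b j)) b≡β))

dyckFrom-true : ∀ h w → dyckFrom h (true ∷ w) ≡ dyckFrom (suc h) w
dyckFrom-true zero    w = refl
dyckFrom-true (suc h) w = refl

-- h + i ∸ j is the height at which the exchanged pair sits, and it must be positive.
dyckFrom-swapAdjacent : ∀ h i j w → suc j ≤ h + i → dyckFrom h (swapAdjacent i j w) ≡ dyckFrom h w
dyckFrom-swapAdjacent h       zero    zero    []                  _ = refl
dyckFrom-swapAdjacent h       zero    zero    (true ∷ [])         _ = refl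
dyckFrom-swapAdjacent h       zero    zero    (false ∷ [])        _ = refl
dyckFrom-swapAdjacent h       zero    zero    (true ∷ true ∷ w)   _ = refl
dyckFrom-swapAdjacent h       zero    zero    (false ∷ false ∷ w) _ = refl
dyckFrom-swapAdjacent (suc h) zero    zero    (true ∷ false ∷ w)  _ = dyckFrom-true h w
dyckFrom-swapAdjacent (suc h) zero    zero    (false ∷ true ∷ w)  _ = sym (dyckFrom-true h w)
dyckFrom-swapAdjacent h       zero    (suc j) []                  _ = refl
dyckFrom-swapAdjacent h       zero    (suc j) (true ∷ w)          _ = refl
dyckFrom-swapAdjacent zero    zero    (suc j) (false ∷ w)         _ = refl
dyckFrom-swapAdjacent (suc h) zero    (suc j) (false ∷ w) (s≤s j<h) =
  dyckFrom-swapAdjacent h zero j w j<h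
dyckFrom-swapAdjacent h       (suc i) zero    []                  _ = refl
dyckFrom-swapAdjacent h       (suc i) (suc j) []                  _ = refl
dyckFrom-swapAdjacent h       (suc i) j       (true ∷ w)        j<h =
  trans (dyckFrom-true h _)
    (trans (dyckFrom-swapAdjacent (suc h) i j w (≤-trans j<h (≤-reflexive (+-suc h i))))
           (sym (dyckFrom-true h w)))
dyckFrom-swapAdjacent h       (suc i) zero    (false ∷ w)         _ = refl
dyckFrom-swapAdjacent zero    (suc i) (suc j) (false ∷ w)         _ = refl
dyckFrom-swapAdjacent (suc h) (suc i) (suc j) (false ∷ w) (s≤s j<h) =
  dyckFrom-swapAdjacent h (suc i) j w j<h

hCount<height : ∀ p h s → T (dyckFrom h (p ++ false ∷ s)) → hCount p < h + vCount p
hCount<height []          (suc h) s _ = s≤s z≤n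
hCount<height (true ∷ p)  h       s d =
  ≤-trans (hCount<height p (suc h) s (subst T (dyckFrom-true h _) d))
          (≤-reflexive (sym (+-suc h (vCount p))))
hCount<height (false ∷ p) (suc h) s d = s≤s (hCount<height p h s d)

swapAdjacent-valley : ∀ p s →
  swapAdjacent (vCount p) (hCount p) (p ++ false ∷ true ∷ s) ≡ p ++ true ∷ false ∷ s
swapAdjacent-valley []          s = refl
swapAdjacent-valley (true ∷ p)  s = cong (true ∷_) (swapAdjacent-valley p s)
swapAdjacent-valley (false ∷ p) s =
  trans (swapAdjacent-false (vCount p) (hCount p) _) (cong (false ∷_) (swapAdjacent-valley p s))

-- Turning a valley of the reference path into a peak

selects : Word → ℕ → ℕ → Word → Bool
selects V k m w = isDyck w ∧ ((desW V w ≡ᵇ k) ∧ (MAJW V w ≡ᵇ m))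

distW-countWords : ∀ V n k m → distW V n k m ≡ countWords (n + n) (selects V k m)
distW-countWords V n k m = trans
  (cong length (filterᵇ-filterᵇ (λ w → (desW V w ≡ᵇ k) ∧ (MAJW V w ≡ᵇ m)) isDyck (allWords (n + n))))
  (length-filterᵇ-allWords (n + n) (selects V k m))

module ValleyToPeak (p s : Word) where
  W W' : Word
  W  = p ++ false ∷ true ∷ s
  W' = p ++ true ∷ false ∷ s

  α β : ℕ
  α = vCount p
  β = hCount p

  open AdjacentPair α β

  P R : List Letter
  P = code p
  R = codeFrom (suc α) (suc β) s

  A∉P : A ∉ P
  A∉P A∈ = <-irrefl refl (proj₂ (codeFrom-v-bounds p A∈))

  B∉P : B ∉ P
  B∉P B∈ = <-irrefl refl (proj₂ (codeFrom-h-bounds p B∈))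

  descentSum-swapAdjacent : ∀ f i w →
    descentSum (flip pos (code W')) f i (code (swapAdjacent α β w)) ≡ descentSum (flip pos (code W)) f i (code w)
  descentSum-swapAdjacent f i w
    rewrite codeFrom-++ 0 0 p (false ∷ true ∷ s) | codeFrom-++ 0 0 p (true ∷ false ∷ s) =
    descentSum-exchanged (consecutiveRanks P R A∉P B∉P) (pos-transpose P R A∉P B∉P) f i
      (codeFrom-swapAdjacent α β w refl refl)

  module _ (dyck : T (isDyck W)) where

    isDyck-swapAdjacent : ∀ w → isDyck (swapAdjacent α β w) ≡ isDyck w
    isDyck-swapAdjacent w = dyckFrom-swapAdjacent 0 α β w (hCount<height p 0 (true ∷ s) dyck)

    selects-swapAdjacent : ∀ k m w → selects W' k m (swapAdjacent α β w) ≡ selects W k m w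
    selects-swapAdjacent k m w =
      cong₂ _∧_ (isDyck-swapAdjacent w) (cong₂ _∧_ (cong (_≡ᵇ k) des≡) (cong (_≡ᵇ m) maj≡))
      where
      des≡ : desW W' (swapAdjacent α β w) ≡ desW W w
      des≡ = trans (desFrom-descentSum (code W') 1 (code (swapAdjacent α β w)))
               (trans (descentSum-swapAdjacent _ 1 w) (sym (desFrom-descentSum (code W) 1 (code w))))
      maj≡ : MAJW W' (swapAdjacent α β w) ≡ MAJW W w
      maj≡ = trans (majFrom-descentSum (code W') 1 (code (swapAdjacent α β w)))
               (trans (descentSum-swapAdjacent _ 1 w) (sym (majFrom-descentSum (code W) 1 (code w))))

    distW-valleyToPeak : ∀ n k m → distW W n k m ≡ distW W' n k m
    distW-valleyToPeak n k m = begin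
      distW W n k m                                     ≡⟨ distW-countWords W n k m ⟩
      countWords (n + n) (selects W k m)                ≡⟨ countWords-cong (n + n) (sym ∘ selects-swapAdjacent k m) ⟩
      countWords (n + n) (selects W' k m ∘ swapAdjacent α β) ≡⟨ countWords-swapAdjacent (n + n) α β _ ⟩
      countWords (n + n) (selects W' k m)               ≡⟨ sym (distW-countWords W' n k m) ⟩
      distW W' n k m                                    ∎
      where open ≡-Reasoning

    isDyck-valleyToPeak : T (isDyck W')
    isDyck-valleyToPeak =
      subst T (trans (sym (isDyck-swapAdjacent W)) (cong isDyck (swapAdjacent-valley p s))) dyck

-- Induction on the number of inversions

inversions : Word → ℕ
inversions []          = 0
inversions (true ∷ w)  = inversions w
inversions (false ∷ w) = vCount w + inversions w

inversions-valleyToPeak : ∀ p s →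
  inversions (p ++ false ∷ true ∷ s) ≡ suc (inversions (p ++ true ∷ false ∷ s))
inversions-valleyToPeak []          s = refl
inversions-valleyToPeak (true ∷ p)  s = inversions-valleyToPeak p s
inversions-valleyToPeak (false ∷ p) s = begin
  vCount (p ++ false ∷ true ∷ s) + inversions (p ++ false ∷ true ∷ s)
    ≡⟨ cong₂ _+_ (trans (vCount-++ p _) (sym (vCount-++ p _))) (inversions-valleyToPeak p s) ⟩
  vCount (p ++ true ∷ false ∷ s) + suc (inversions (p ++ true ∷ false ∷ s))
    ≡⟨ +-suc _ _ ⟩
  suc (vCount (p ++ true ∷ false ∷ s) + inversions (p ++ true ∷ false ∷ s)) ∎
  where open ≡-Reasoning

valley-or-sorted : ∀ W →
  (∃[ p ] ∃[ s ] W ≡ p ++ false ∷ true ∷ s) ⊎ (∃[ a ] ∃[ b ] W ≡ replicateB a true ++ replicateB b false)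
valley-or-sorted [] = inj₂ (0 , 0 , refl)
valley-or-sorted (true ∷ W) with valley-or-sorted W
... | inj₁ (p , s , refl) = inj₁ (true ∷ p , s , refl)
... | inj₂ (a , b , refl) = inj₂ (suc a , b , refl)
valley-or-sorted (false ∷ W) with valley-or-sorted W
... | inj₁ (p , s , refl)     = inj₁ (false ∷ p , s , refl)
... | inj₂ (zero , b , refl)  = inj₂ (0 , suc b , refl)
... | inj₂ (suc a , b , refl) = inj₁ ([] , replicateB a true ++ replicateB b false , refl)

dyckFrom-replicate-true : ∀ a h w → dyckFrom h (replicateB a true ++ w) ≡ dyckFrom (a + h) w
dyckFrom-replicate-true zero    h w = refl
dyckFrom-replicate-true (suc a) h w =
  trans (dyckFrom-true h _) (trans (dyckFrom-replicate-true a (suc h) w) (cong (flip dyckFrom w) (+-suc a h)))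

dyckFrom-replicate-false : ∀ b h → T (dyckFrom h (replicateB b false)) → h ≡ b
dyckFrom-replicate-false zero    zero    _ = refl
dyckFrom-replicate-false (suc b) (suc h) d = cong suc (dyckFrom-replicate-false b h d)

length-replicateB : ∀ a x → length (replicateB a x) ≡ a
length-replicateB zero    x = refl
length-replicateB (suc a) x = cong suc (length-replicateB a x)

+-diagonal-injective : ∀ a n → a + a ≡ n + n → a ≡ n
+-diagonal-injective zero    zero    _  = refl
+-diagonal-injective (suc a) (suc n) eq rewrite +-suc a a | +-suc n n =
  cong suc (+-diagonal-injective a n (suc-injective (suc-injective eq)))

sorted-dyck : ∀ a b n → T (isDyck (replicateB a true ++ replicateB b false)) →
  length (replicateB a true ++ replicateB b false) ≡ n + n →
  replicateB a true ++ replicateB b false ≡ W₀ n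
sorted-dyck a b n dyck len = cong₂ (λ x y → replicateB x true ++ replicateB y false) a≡n b≡n
  where
  a≡b : a ≡ b
  a≡b = trans (sym (+-identityʳ a))
          (dyckFrom-replicate-false b (a + 0) (subst T (dyckFrom-replicate-true a 0 _) dyck))
  a+b≡n+n : a + b ≡ n + n
  a+b≡n+n = trans (sym (trans (length-++ (replicateB a true))
                         (cong₂ _+_ (length-replicateB a true) (length-replicateB b false))))
                  len
  a≡n : a ≡ n
  a≡n = +-diagonal-injective a n (trans (cong (a +_) a≡b) a+b≡n+n)
  b≡n : b ≡ n
  b≡n = trans (sym a≡b) a≡n

distW-W₀ : ∀ t n W → inversions W ≡ t → T (isDyck W) → length W ≡ n + n →
  ∀ k m → distW W n k m ≡ distW (W₀ n) n k m
distW-W₀ t n W inv dyck len k m with valley-or-sorted W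
... | inj₂ (a , b , refl) = cong (λ V → distW V n k m) (sorted-dyck a b n dyck len)
... | inj₁ (p , s , refl) with t
...   | zero   = contradiction (trans (sym (inversions-valleyToPeak p s)) inv) λ ()
...   | suc t' = trans (distW-valleyToPeak dyck n k m)
          (distW-W₀ t' n W' (suc-injective (trans (sym (inversions-valleyToPeak p s)) inv))
            (isDyck-valleyToPeak dyck) (trans (trans (length-++ p) (sym (length-++ p))) len) k m)
  where open ValleyToPeak p s

corollary2p3 : (n : ℕ) → 1 ≤ n → (W : Word) → T (isDyck W) → length W ≡ n + n → (k m : ℕ) → distW W n k m ≡ Nq n k m
corollary2p3 n _ W dyck len k m = distW-W₀ (inversions W) n W refl dyck len k m
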